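{- Let $\mathcal{X}$ be a family of nonempty subsets of $[d]$. If $v_{\mathcal{X}}$ is submodular and there exists at least one $\mathcal{X}$-matroid on $[d]$, then $v_{\mathcal{X}}$ is the rank function of the unique minimal $\mathcal{X}$-matroid (minimal with respect to the dependency order).
   Context: An $\mathcal{X}$-matroid is a matroid on $[d]$ in which every set of $\mathcal{X}$ is a circuit. Dependency order: $N_1\le N_2$ iff every dependent set of $N_1$ is dependent in $N_2$. A proper $\mathcal{X}$-sequence is a (possibly empty) sequence $\mathcal{S}=(X_1,\dots,X_k)$ of sets in $\mathcal{X}$ with $X_i\not\subseteq\bigcup_{j<i}X_j$ for $i\ge2$; $\mathrm{val}(F,\mathcal{S})=|F\cup\bigcup_iX_i|-k$, $\mathrm{val}_{\mathcal{X}}(F)=\min_{\mathcal{S}}\mathrm{val}(F,\mathcal{S})$. Starting from $h_1=\mathrm{val}_{\mathcal{X}}$, functions $h_n:2^{[d]}\to\mathbb{Z}$ are updated by: (i) if there exist $A,B\subseteq[d]$, $x\in\mathcal{X}$ with $A\cap B\subseteq x$ and $h_n(A\cup B)>h_n(A)+h_n(B)-\min\{|A\cap B|,|x|-1\}$, set $h_{n+1}(A\cup B)$ equal to the right-hand side (other values unchanged); (ii) otherwise, if some $A\subsetneq B$ has $h_n(A)>h_n(B)$, set $h_{n+1}(A)=h_n(B)$; (iii) otherwise, if some $B\subsetneq A$ has $h_n(A)>h_n(B)+|A\setminus B|$, set $h_{n+1}(A)=h_n(B)+|A\setminus B|$; (iv) otherwise $h_{n+1}=h_n$. The sequence eventually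 stabilizes, and its final value, which does not depend on the choices made, is $v_{\mathcal{X}}$. -}

module Defs where

open import Data.Nat as ℕ using (ℕ)
open import Data.Integer as ℤ using (ℤ; +_; _-_; _+_; _≤_; _<_; _⊓_)
open import Data.Bool using (Bool; true; false)
open import Data.List using (List; []; _∷_; length)
open import Data.Fin using (Fin)
open import Data.Fin.Subset
  using (Subset; _∈_; _∉_; _⊆_; _⊂_; _∪_; _∩_; _─_; ⁅_⁆; ⊥; ⋃; ∣_∣; Nonempty)
open import Data.Product using (Σ; ∃; ∃-syntax; _×_; _,_)
open import Data.Sum using (_⊎_)
open import Data.Unit using (⊤)
open import Relation.Nullary using (¬_)
open import Relation.Binary.PropositionalEquality using (_≡_; _≢_)
open import Relation.Binary.Construct.Closure.ReflexiveTransitive using (Star)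

Family : ℕ → Set
Family d = Subset d → Bool

_∈𝒳_ : ∀ {d} → Subset d → Family d → Set
X ∈𝒳 𝒳 = 𝒳 X ≡ true

record Matroid (d : ℕ) : Set where
  field
    indep    : Subset d → Bool
    indep-⊥  : indep ⊥ ≡ true
    indep-⊆  : ∀ {I J} → J ⊆ I → indep I ≡ true → indep J ≡ true
    augment  : ∀ {I J} → indep I ≡ true → indep J ≡ true → ∣ I ∣ ℕ.< ∣ J ∣ →
               ∃[ e ] (e ∈ J × e ∉ I × indep (⁅ e ⁆ ∪ I) ≡ true)

open Matroid public

Independent : ∀ {d} → Matroid d → Subset d → Set
Independent M I = indep M I ≡ true

Dependent : ∀ {d} → Matroid d → Subset d → Set
Dependent M I = indep M I ≡ false

IsCircuit : ∀ {d} → Matroid d → Subset d → Set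
IsCircuit M C = Dependent M C × (∀ D → D ⊂ C → Independent M D)

IsXMatroid : ∀ {d} → Family d → Matroid d → Set
IsXMatroid 𝒳 M = ∀ X → X ∈𝒳 𝒳 → IsCircuit M X

_≼_ : ∀ {d} → Matroid d → Matroid d → Set
N₁ ≼ N₂ = ∀ A → Dependent N₁ A → Dependent N₂ A

IsRankFunction : ∀ {d} → Matroid d → (Subset d → ℤ) → Set
IsRankFunction M r = ∀ A →
  (∃[ I ] (I ⊆ A × Independent M I × + ∣ I ∣ ≡ r A)) ×
  (∀ I → I ⊆ A → Independent M I → + ∣ I ∣ ≤ r A)

Submodular : ∀ {d} → (Subset d → ℤ) → Set
Submodular f = ∀ A B → f (A ∪ B) + f (A ∩ B) ≤ f A + f B

-- Proper 𝒳-sequences (X₁ , … , Xₖ), listed with X₁ first.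

-- ProperFrom 𝒳 U S : S continues a proper sequence whose earlier
-- members have union U.
ProperFrom : ∀ {d} → Family d → Subset d → List (Subset d) → Set
ProperFrom 𝒳 U []      = ⊤
ProperFrom 𝒳 U (X ∷ S) = X ∈𝒳 𝒳 × ¬ (X ⊆ U) × ProperFrom 𝒳 (U ∪ X) S

Proper : ∀ {d} → Family d → List (Subset d) → Set
Proper 𝒳 []      = ⊤
Proper 𝒳 (X ∷ S) = X ∈𝒳 𝒳 × ProperFrom 𝒳 X S

val : ∀ {d} → Subset d → List (Subset d) → ℤ
val F S = + ∣ F ∪ ⋃ S ∣ - + length S

IsValX : ∀ {d} → Family d → (Subset d → ℤ) → Set
IsValX 𝒳 h = ∀ F →
  (∃[ S ] (Proper 𝒳 S × val F S ≡ h F)) ×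
  (∀ S → Proper 𝒳 S → h F ≤ val F S)

UpdateAt : ∀ {d} → (Subset d → ℤ) → Subset d → ℤ → (Subset d → ℤ) → Set
UpdateAt h C z g = ∀ D → (D ≡ C → g D ≡ z) × (D ≢ C → g D ≡ h D)

rhs-i : ∀ {d} → (Subset d → ℤ) → Subset d → Subset d → Subset d → ℤ
rhs-i h A B x = (h A + h B) - ((+ ∣ A ∩ B ∣) ⊓ (+ ∣ x ∣ - + 1))

Rule-i : ∀ {d} → Family d → (Subset d → ℤ) → Subset d → Subset d → Subset d → Set
Rule-i 𝒳 h A B x = x ∈𝒳 𝒳 × (A ∩ B) ⊆ x × rhs-i h A B x < h (A ∪ B)

Rule-ii : ∀ {d} → (Subset d → ℤ) → Subset d → Subset d → Set
Rule-ii h A B = A ⊂ B × h B < h A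

Rule-iii : ∀ {d} → (Subset d → ℤ) → Subset d → Subset d → Set
Rule-iii h A B = B ⊂ A × h B + + ∣ A ─ B ∣ < h A

NoRule-i : ∀ {d} → Family d → (Subset d → ℤ) → Set
NoRule-i 𝒳 h = ∀ A B x → ¬ Rule-i 𝒳 h A B x

NoRule-ii : ∀ {d} → (Subset d → ℤ) → Set
NoRule-ii h = ∀ A B → ¬ Rule-ii h A B

NoRule-iii : ∀ {d} → (Subset d → ℤ) → Set
NoRule-iii h = ∀ A B → ¬ Rule-iii h A B

data Step {d} (𝒳 : Family d) (h : Subset d → ℤ) : (Subset d → ℤ) → Set where
  step-i   : ∀ {g} A B x → Rule-i 𝒳 h A B x →
             UpdateAt h (A ∪ B) (rhs-i h A B x) g → Step 𝒳 h g
  step-ii  : ∀ {g} A B → NoRule-i 𝒳 h → Rule-ii h A B →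
             UpdateAt h A (h B) g → Step 𝒳 h g
  step-iii : ∀ {g} A B → NoRule-i 𝒳 h → NoRule-ii h → Rule-iii h A B →
             UpdateAt h A (h B + + ∣ A ─ B ∣) g → Step 𝒳 h g

-- stabilised: none of the rules (i)-(iii) applies (only rule (iv))
Stable : ∀ {d} → Family d → (Subset d → ℤ) → Set
Stable 𝒳 h = NoRule-i 𝒳 h × NoRule-ii h × NoRule-iii h

-- v is v_𝒳: the final value of a run of the process started at
-- h₁ = val_𝒳 (independent of the choices made)
IsVX : ∀ {d} → Family d → (Subset d → ℤ) → Set
IsVX 𝒳 v = ∃[ h₁ ] (IsValX 𝒳 h₁ × Star (Step 𝒳) h₁ v × Stable 𝒳 v)

{-# OPTIONS --safe #-}
-- Let r_N be the rank function of an 𝒳-matroid N. The union of a proper 𝒳-sequence of k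
-- circuits has rank at most its size minus k, so val_𝒳 ≥ r_N, and every update rule keeps
-- h ≥ r_N: rule (i) by submodularity of r_N together with r_N(A ∩ B) ≥ min{|A ∩ B|, |x| - 1},
-- rules (ii) and (iii) because r_N is monotone with unit increase. Hence v_𝒳 ≥ r_N.
-- The rules only lower values, so v_𝒳 ≤ val_𝒳, which gives v_𝒳(∅) = 0 and v_𝒳(X) < |X| for
-- X ∈ 𝒳. Stability makes v_𝒳 monotone with unit increase, so, being submodular, it is the
-- rank function of the matroid M whose independent sets are the I with |I| ≤ v_𝒳(I).
-- M is an 𝒳-matroid, and v_𝒳 ≥ r_N turns every M-dependent set into an N-dependent one,
-- so M lies below every 𝒳-matroid in the dependency order.
module Submission where

open import Defs
open import Data.Nat using (ℕ)
open import Data.Integer using (ℤ)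
open import Data.Fin.Subset using (Subset; Nonempty)
open import Data.Product using (∃-syntax; _×_)

open import Data.Nat as ℕ using (suc; z≤n; s≤s)
import Data.Nat.Properties as ℕ
import Data.Nat.Tactic.RingSolver as ℕ-Solver
import Data.Integer as ℤ
import Data.Integer.Properties as ℤ
import Data.Integer.Tactic.RingSolver as ℤ-Solver
open import Data.Bool using (Bool; true; false)
import Data.Bool.Properties as Bool
open import Data.Fin using (Fin)
import Data.Fin.Properties as Fin
open import Data.Fin.Subset
  using (_∈_; _∉_; _⊆_; _⊂_; _⊃_; _∪_; _∩_; _─_; _-_; ⁅_⁆; ⊥; ⋃; ∣_∣)
open import Data.Fin.Subset.Properties
open import Data.Fin.Subset.Induction using (⊂-wellFounded; ⊃-wellFounded)
open import Data.Vec using ([]; _∷_; here; there)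
open import Data.Vec.Properties using (≡-dec)
open import Data.List using ([]; _∷_; length)
open import Data.Product using (_,_; proj₁; proj₂)
open import Data.Sum using (_⊎_; inj₁; inj₂)
open import Data.Empty using (⊥-elim)
open import Data.Unit using (tt)
open import Function using (_∘_; id)
open import Induction.WellFounded using (Acc; acc)
open import Relation.Nullary using (¬_; Dec; does; yes; no; ¬?; contradiction)
open import Relation.Nullary.Decidable using (_×-dec_; dec-true; dec-false)
open import Relation.Binary.PropositionalEquality
  using (_≡_; refl; sym; trans; cong; cong₂; subst; subst₂; module ≡-Reasoning)
open import Relation.Binary.Construct.Closure.ReflexiveTransitive using (Star)
import Relation.Binary.Construct.Closure.ReflexiveTransitive as Star

∣p∪q∣+∣p∩q∣≡∣p∣+∣q∣ : ∀ {n} (p q : Subset n) → ∣ p ∪ q ∣ ℕ.+ ∣ p ∩ q ∣ ≡ ∣ p ∣ ℕ.+ ∣ q ∣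
∣p∪q∣+∣p∩q∣≡∣p∣+∣q∣ []          []          = refl
∣p∪q∣+∣p∩q∣≡∣p∣+∣q∣ (true ∷ p)  (true ∷ q)  = cong suc (begin
  ∣ p ∪ q ∣ ℕ.+ suc ∣ p ∩ q ∣ ≡⟨ ℕ.+-suc _ _ ⟩
  suc (∣ p ∪ q ∣ ℕ.+ ∣ p ∩ q ∣) ≡⟨ cong suc (∣p∪q∣+∣p∩q∣≡∣p∣+∣q∣ p q) ⟩
  suc (∣ p ∣ ℕ.+ ∣ q ∣) ≡⟨ ℕ.+-suc _ _ ⟨
  ∣ p ∣ ℕ.+ suc ∣ q ∣ ∎)
  where open ≡-Reasoning
∣p∪q∣+∣p∩q∣≡∣p∣+∣q∣ (true ∷ p)  (false ∷ q) = cong suc (∣p∪q∣+∣p∩q∣≡∣p∣+∣q∣ p q)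
∣p∪q∣+∣p∩q∣≡∣p∣+∣q∣ (false ∷ p) (true ∷ q)  =
  trans (cong suc (∣p∪q∣+∣p∩q∣≡∣p∣+∣q∣ p q)) (sym (ℕ.+-suc _ _))
∣p∪q∣+∣p∩q∣≡∣p∣+∣q∣ (false ∷ p) (false ∷ q) = ∣p∪q∣+∣p∩q∣≡∣p∣+∣q∣ p q

∣p∩q∣+∣p─q∣≡∣p∣ : ∀ {n} (p q : Subset n) → ∣ p ∩ q ∣ ℕ.+ ∣ p ─ q ∣ ≡ ∣ p ∣
∣p∩q∣+∣p─q∣≡∣p∣ []          []          = refl
∣p∩q∣+∣p─q∣≡∣p∣ (true ∷ p)  (true ∷ q)  = cong suc (∣p∩q∣+∣p─q∣≡∣p∣ p q)
∣p∩q∣+∣p─q∣≡∣p∣ (true ∷ p)  (false ∷ q) =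
  trans (ℕ.+-suc _ _) (cong suc (∣p∩q∣+∣p─q∣≡∣p∣ p q))
∣p∩q∣+∣p─q∣≡∣p∣ (false ∷ p) (true ∷ q)  = ∣p∩q∣+∣p─q∣≡∣p∣ p q
∣p∩q∣+∣p─q∣≡∣p∣ (false ∷ p) (false ∷ q) = ∣p∩q∣+∣p─q∣≡∣p∣ p q

∣⁅x⁆∪p∣≤1+∣p∣ : ∀ {n} (x : Fin n) (p : Subset n) → ∣ ⁅ x ⁆ ∪ p ∣ ℕ.≤ suc ∣ p ∣
∣⁅x⁆∪p∣≤1+∣p∣ x p = begin
  ∣ ⁅ x ⁆ ∪ p ∣                     ≤⟨ ℕ.m≤m+n _ _ ⟩
  ∣ ⁅ x ⁆ ∪ p ∣ ℕ.+ ∣ ⁅ x ⁆ ∩ p ∣ ≡⟨ ∣p∪q∣+∣p∩q∣≡∣p∣+∣q∣ ⁅ x ⁆ p ⟩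
  ∣ ⁅ x ⁆ ∣ ℕ.+ ∣ p ∣             ≡⟨ cong (ℕ._+ ∣ p ∣) (∣⁅x⁆∣≡1 x) ⟩
  suc ∣ p ∣                         ∎
  where open ℕ.≤-Reasoning

∣p∣≤1+∣p-x∣ : ∀ {n} (p : Subset n) (x : Fin n) → ∣ p ∣ ℕ.≤ suc ∣ p - x ∣
∣p∣≤1+∣p-x∣ p x = begin
  ∣ p ∣                             ≡⟨ ∣p∩q∣+∣p─q∣≡∣p∣ p ⁅ x ⁆ ⟨
  ∣ p ∩ ⁅ x ⁆ ∣ ℕ.+ ∣ p - x ∣     ≤⟨ ℕ.+-monoˡ-≤ _ (∣p∩q∣≤∣q∣ p ⁅ x ⁆) ⟩
  ∣ ⁅ x ⁆ ∣ ℕ.+ ∣ p - x ∣         ≡⟨ cong (ℕ._+ ∣ p - x ∣) (∣⁅x⁆∣≡1 x) ⟩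
  suc ∣ p - x ∣                     ∎
  where open ℕ.≤-Reasoning

p⊈q⇒∃x∈p∖q : ∀ {n} {p q : Subset n} → ¬ p ⊆ q → ∃[ x ] (x ∈ p × x ∉ q)
p⊈q⇒∃x∈p∖q {p = p} {q} p⊈q with Fin.any? (λ x → x ∈? p ×-dec ¬? (x ∈? q))
... | yes w = w
... | no ∄x = ⊥-elim (p⊈q p⊆q)
  where
  p⊆q : p ⊆ q
  p⊆q {x} x∈p with x ∈? q
  ... | yes x∈q = x∈q
  ... | no x∉q = contradiction (x , x∈p , x∉q) ∄x

p⊆q⇒p≡q⊎p⊂q : ∀ {n} {p q : Subset n} → p ⊆ q → p ≡ q ⊎ p ⊂ q
p⊆q⇒p≡q⊎p⊂q {p = p} {q} p⊆q with q ⊆? p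
... | yes q⊆p = inj₁ (⊆-antisym p⊆q q⊆p)
... | no q⊈p = inj₂ (p⊆q , p⊈q⇒∃x∈p∖q q⊈p)

x∉p⇒p⊂⁅x⁆∪p : ∀ {n} {x : Fin n} {p : Subset n} → x ∉ p → p ⊂ ⁅ x ⁆ ∪ p
x∉p⇒p⊂⁅x⁆∪p {x = x} {p} x∉p = q⊆p∪q ⁅ x ⁆ p , x , p⊆p∪q p (x∈⁅x⁆ x) , x∉p

x∈p─q⇒x∉q : ∀ {n} (p q : Subset n) {x} → x ∈ p ─ q → x ∉ q
x∈p─q⇒x∉q (_ ∷ p) (true ∷ q) ()          here
x∈p─q⇒x∉q (_ ∷ p) (_ ∷ q)    (there x∈p─q) (there x∈q) = x∈p─q⇒x∉q p q x∈p─q x∈q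

─-monoˡ-⊆ : ∀ {n} {p q : Subset n} (r : Subset n) → p ⊆ q → p ─ r ⊆ q ─ r
─-monoˡ-⊆ {p = p} r p⊆q x∈p─r = x∈p∧x∉q⇒x∈p─q (p⊆q (p─q⊆p p r x∈p─r)) (x∈p─q⇒x∉q p r x∈p─r)

∪-least : ∀ {n} {p q r : Subset n} → p ⊆ r → q ⊆ r → p ∪ q ⊆ r
∪-least {p = p} {q} p⊆r q⊆r x∈p∪q with x∈p∪q⁻ p q x∈p∪q
... | inj₁ x∈p = p⊆r x∈p
... | inj₂ x∈q = q⊆r x∈q

∩-greatest : ∀ {n} {p q r : Subset n} → r ⊆ p → r ⊆ q → r ⊆ p ∩ q
∩-greatest r⊆p r⊆q x∈r = x∈p∩q⁺ (r⊆p x∈r , r⊆q x∈r)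

x∈p⇒⁅x⁆⊆p : ∀ {n} {x : Fin n} {p : Subset n} → x ∈ p → ⁅ x ⁆ ⊆ p
x∈p⇒⁅x⁆⊆p {x = x} x∈p y∈⁅x⁆ rewrite x∈⁅y⁆⇒x≡y x y∈⁅x⁆ = x∈p

p⊆⁅x⁆∪p-x : ∀ {n} (p : Subset n) (x : Fin n) → p ⊆ ⁅ x ⁆ ∪ (p - x)
p⊆⁅x⁆∪p-x p x {y} y∈p with y Fin.≟ x
... | yes refl = p⊆p∪q (p - x) (x∈⁅x⁆ x)
... | no y≢x   = q⊆p∪q ⁅ x ⁆ (p - x) (x∈p∧x≢y⇒x∈p-y y∈p y≢x)

i+k≤j+k⇒i≤j : ∀ {i j} k → i ℤ.+ k ℤ.≤ j ℤ.+ k → i ℤ.≤ j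
i+k≤j+k⇒i≤j {i} {j} k i+k≤j+k = begin
  i                 ≡⟨ i≡i+k-k i k ⟩
  i ℤ.+ k ℤ.- k   ≤⟨ ℤ.+-monoˡ-≤ (ℤ.- k) i+k≤j+k ⟩
  j ℤ.+ k ℤ.- k   ≡⟨ i≡i+k-k j k ⟨
  j                 ∎
  where
  open ℤ.≤-Reasoning
  i≡i+k-k : ∀ i k → i ≡ i ℤ.+ k ℤ.- k
  i≡i+k-k = ℤ-Solver.solve-∀

i+j≤k⇒i≤k-j : ∀ {i j k} → i ℤ.+ j ℤ.≤ k → i ℤ.≤ k ℤ.- j
i+j≤k⇒i≤k-j {i} {j} {k} i+j≤k = i+k≤j+k⇒i≤j j (ℤ.≤-trans i+j≤k (ℤ.≤-reflexive (k≡k-j+j k j)))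
  where
  k≡k-j+j : ∀ k j → k ≡ k ℤ.- j ℤ.+ j
  k≡k-j+j = ℤ-Solver.solve-∀

m+k≤n⇒+m≤+n-+k : ∀ {m k n} → m ℕ.+ k ℕ.≤ n → ℤ.+ m ℤ.≤ ℤ.+ n ℤ.- ℤ.+ k
m+k≤n⇒+m≤+n-+k {m} {k} {n} m+k≤n =
  i+j≤k⇒i≤k-j {j = ℤ.+ k} (subst (ℤ._≤ ℤ.+ n) (ℤ.pos-+ m k) (ℤ.+≤+ m+k≤n))


does≡true⇒ : ∀ {A : Set} (a? : Dec A) → does a? ≡ true → A
does≡true⇒ (yes a) _ = a

does≡false⇒ : ∀ {A : Set} (a? : Dec A) → does a? ≡ false → ¬ A
does≡false⇒ (no ¬a) _ = ¬a

independent⇒¬dependent : ∀ {d} (M : Matroid d) {A} → Independent M A → ¬ Dependent M A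
independent⇒¬dependent M A-ind A-dep = contradiction (trans (sym A-ind) A-dep) λ ()

module MatroidRank {d} (N : Matroid d) where

  record IsBasis (E J : Subset d) : Set where
    field
      ⊆E          : J ⊆ E
      independent : Independent N J
      maximal     : ∀ f → f ∈ E → f ∉ J → Dependent N (⁅ f ⁆ ∪ J)

  extend-to-basis : ∀ {E K} → K ⊆ E → Independent N K → ∃[ J ] (K ⊆ J × IsBasis E J)
  extend-to-basis {E} {K} = go (⊃-wellFounded K)
    where
    go : ∀ {K} → Acc _⊃_ K → K ⊆ E → Independent N K → ∃[ J ] (K ⊆ J × IsBasis E J)
    go {K} (acc larger) K⊆E K-ind
      with Fin.any? (λ f → f ∈? E ×-dec ¬? (f ∈? K) ×-dec (indep N (⁅ f ⁆ ∪ K) Bool.≟ true))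
    ... | yes (f , f∈E , f∉K , K+f-ind) =
      let J , K+f⊆J , J-basis = go (larger (x∉p⇒p⊂⁅x⁆∪p f∉K)) (∪-least (x∈p⇒⁅x⁆⊆p f∈E) K⊆E) K+f-ind
      in J , (λ x∈K → K+f⊆J (q⊆p∪q ⁅ f ⁆ K x∈K)) , J-basis
    ... | no ∄f = K , ⊆-refl , record
      { ⊆E          = K⊆E
      ; independent = K-ind
      ; maximal     = λ f f∈E f∉K → Bool.¬-not (λ K+f-ind → ∄f (f , f∈E , f∉K , K+f-ind))
      }

  basis-largest : ∀ {E J I} → IsBasis E J → I ⊆ E → Independent N I → ∣ I ∣ ℕ.≤ ∣ J ∣
  basis-largest {J = J} {I} J-basis I⊆E I-ind with ∣ I ∣ ℕ.≤? ∣ J ∣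
  ... | yes ∣I∣≤∣J∣ = ∣I∣≤∣J∣
  ... | no ∣I∣≰∣J∣ with augment N (IsBasis.independent J-basis) I-ind (ℕ.≰⇒> ∣I∣≰∣J∣)
  ...   | e , e∈I , e∉J , J+e-ind =
    contradiction (IsBasis.maximal J-basis e (I⊆E e∈I) e∉J) (independent⇒¬dependent N J+e-ind)

  basisOf : Subset d → Subset d
  basisOf E = proj₁ (extend-to-basis (⊆-min E) (indep-⊥ N))

  basisOf-isBasis : ∀ E → IsBasis E (basisOf E)
  basisOf-isBasis E = proj₂ (proj₂ (extend-to-basis (⊆-min E) (indep-⊥ N)))

  rank : Subset d → ℕ
  rank E = ∣ basisOf E ∣

  independent⇒∣∣≤rank : ∀ {I E} → I ⊆ E → Independent N I → ∣ I ∣ ℕ.≤ rank E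
  independent⇒∣∣≤rank {E = E} = basis-largest (basisOf-isBasis E)

  independent-∩⇒≤rank : ∀ {I} → Independent N I → ∀ E → ∣ I ∩ E ∣ ℕ.≤ rank E
  independent-∩⇒≤rank {I} I-ind E = independent⇒∣∣≤rank (p∩q⊆q I E) (indep-⊆ N (p∩q⊆p I E) I-ind)

  rank≤basis : ∀ {E J} → IsBasis E J → rank E ℕ.≤ ∣ J ∣
  rank≤basis {E} J-basis = basis-largest J-basis (IsBasis.⊆E B) (IsBasis.independent B)
    where
    B : IsBasis E (basisOf E)
    B = basisOf-isBasis E

  rank≤∣∣ : ∀ E → rank E ℕ.≤ ∣ E ∣
  rank≤∣∣ E = p⊆q⇒∣p∣≤∣q∣ (IsBasis.⊆E (basisOf-isBasis E))

  rank-mono : ∀ {A B} → A ⊆ B → rank A ℕ.≤ rank B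
  rank-mono {A} A⊆B = independent⇒∣∣≤rank (⊆-trans ⊆E A⊆B) independent
    where open IsBasis (basisOf-isBasis A)

  rank-unit-increase : ∀ A B → rank A ℕ.≤ rank B ℕ.+ ∣ A ─ B ∣
  rank-unit-increase A B = begin
    ∣ J ∣                       ≡⟨ ∣p∩q∣+∣p─q∣≡∣p∣ J B ⟨
    ∣ J ∩ B ∣ ℕ.+ ∣ J ─ B ∣   ≤⟨ ℕ.+-mono-≤ (independent-∩⇒≤rank independent B)
                                              (p⊆q⇒∣p∣≤∣q∣ (─-monoˡ-⊆ B ⊆E)) ⟩
    rank B ℕ.+ ∣ A ─ B ∣       ∎
    where
    open ℕ.≤-Reasoning
    J : Subset d
    J = basisOf A
    open IsBasis (basisOf-isBasis A)

  independent-∪-∩-≤ : ∀ {A B J K} → Independent N J → J ⊆ A ∪ B → K ⊆ J → K ⊆ A ∩ B →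
                      ∣ J ∣ ℕ.+ ∣ K ∣ ℕ.≤ rank A ℕ.+ rank B
  independent-∪-∩-≤ {A} {B} {J} {K} J-ind J⊆A∪B K⊆J K⊆A∩B = begin
    ∣ J ∣ ℕ.+ ∣ K ∣                                     ≤⟨ ℕ.+-mono-≤ (p⊆q⇒∣p∣≤∣q∣ J⊆JA∪JB)
                                                                     (p⊆q⇒∣p∣≤∣q∣ K⊆JA∩JB) ⟩
    ∣ (J ∩ A) ∪ (J ∩ B) ∣ ℕ.+ ∣ (J ∩ A) ∩ (J ∩ B) ∣ ≡⟨ ∣p∪q∣+∣p∩q∣≡∣p∣+∣q∣ (J ∩ A) (J ∩ B) ⟩
    ∣ J ∩ A ∣ ℕ.+ ∣ J ∩ B ∣                           ≤⟨ ℕ.+-mono-≤ (independent-∩⇒≤rank J-ind A)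
                                                                     (independent-∩⇒≤rank J-ind B) ⟩
    rank A ℕ.+ rank B                                   ∎
    where
    open ℕ.≤-Reasoning
    J⊆JA∪JB : J ⊆ (J ∩ A) ∪ (J ∩ B)
    J⊆JA∪JB x∈J with x∈p∪q⁻ A B (J⊆A∪B x∈J)
    ... | inj₁ x∈A = x∈p∪q⁺ (inj₁ (x∈p∩q⁺ (x∈J , x∈A)))
    ... | inj₂ x∈B = x∈p∪q⁺ (inj₂ (x∈p∩q⁺ (x∈J , x∈B)))
    K⊆JA∩JB : K ⊆ (J ∩ A) ∩ (J ∩ B)
    K⊆JA∩JB = ∩-greatest (∩-greatest K⊆J (⊆-trans K⊆A∩B (p∩q⊆p A B)))
                         (∩-greatest K⊆J (⊆-trans K⊆A∩B (p∩q⊆q A B)))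

  rank-submodular : ∀ A B → rank (A ∪ B) ℕ.+ rank (A ∩ B) ℕ.≤ rank A ℕ.+ rank B
  rank-submodular A B =
    let J , K⊆J , J-basis = extend-to-basis (⊆-trans K⊆A∩B (⊆-trans (p∩q⊆p A B) (p⊆p∪q B))) K-ind
    in ℕ.≤-trans (ℕ.+-monoˡ-≤ (rank (A ∩ B)) (rank≤basis J-basis))
                 (independent-∪-∩-≤ (IsBasis.independent J-basis) (IsBasis.⊆E J-basis) K⊆J K⊆A∩B)
    where open IsBasis (basisOf-isBasis (A ∩ B)) using () renaming (⊆E to K⊆A∩B; independent to K-ind)

  dependent⇒∣basis∣<∣∣ : ∀ {E J} → IsBasis E J → Dependent N E → ∣ J ∣ ℕ.< ∣ E ∣
  dependent⇒∣basis∣<∣∣ J-basis E-dep with p⊆q⇒p≡q⊎p⊂q (IsBasis.⊆E J-basis)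
  ... | inj₁ refl = contradiction E-dep (independent⇒¬dependent N (IsBasis.independent J-basis))
  ... | inj₂ J⊂E  = p⊂q⇒∣p∣<∣q∣ J⊂E

  dependent⇒rank<∣∣ : ∀ {A} → Dependent N A → rank A ℕ.< ∣ A ∣
  dependent⇒rank<∣∣ {A} = dependent⇒∣basis∣<∣∣ (basisOf-isBasis A)

  circuit-rank : ∀ {X} → IsCircuit N X → ∣ X ∣ ℕ.≤ suc (rank X)
  circuit-rank {X} (X-dep , X-minimal) with nonempty? X
  ... | yes (e , e∈X) = ℕ.≤-trans (∣p∣≤1+∣p-x∣ X e)
    (s≤s (independent⇒∣∣≤rank (p─q⊆p X ⁅ e ⁆) (X-minimal (X - e) (x∈p⇒p-x⊂p e∈X))))
  ... | no X-empty = contradiction (subst (Dependent N) (Empty-unique X-empty) X-dep)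
                                   (independent⇒¬dependent N (indep-⊥ N))

  RankDeficit : Subset d → ℕ → Set
  RankDeficit U m = rank U ℕ.+ m ℕ.≤ ∣ U ∣

  rank-∪-circuit : ∀ {U X m} → IsCircuit N X → ¬ X ⊆ U → RankDeficit U m → RankDeficit (U ∪ X) (suc m)
  rank-∪-circuit {U} {X} {m} (X-dep , X-minimal) X⊈U U-deficit = ℕ.+-cancelʳ-≤ ∣ U ∩ X ∣ _ _ (begin
    rank (U ∪ X) ℕ.+ suc m ℕ.+ ∣ U ∩ X ∣         ≤⟨ ℕ.+-monoʳ-≤ _ (independent⇒∣∣≤rank ⊆-refl U∩X-ind) ⟩
    rank (U ∪ X) ℕ.+ suc m ℕ.+ rank (U ∩ X)     ≡⟨ swap (rank (U ∪ X)) (suc m) (rank (U ∩ X)) ⟩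
    rank (U ∪ X) ℕ.+ rank (U ∩ X) ℕ.+ suc m     ≤⟨ ℕ.+-monoˡ-≤ (suc m) (rank-submodular U X) ⟩
    rank U ℕ.+ rank X ℕ.+ suc m                  ≡⟨ regroup (rank U) (rank X) m ⟩
    (rank U ℕ.+ m) ℕ.+ suc (rank X)              ≤⟨ ℕ.+-mono-≤ U-deficit (dependent⇒rank<∣∣ X-dep) ⟩
    ∣ U ∣ ℕ.+ ∣ X ∣                               ≡⟨ ∣p∪q∣+∣p∩q∣≡∣p∣+∣q∣ U X ⟨
    ∣ U ∪ X ∣ ℕ.+ ∣ U ∩ X ∣                       ∎)
    where
    open ℕ.≤-Reasoning
    U∩X-ind : Independent N (U ∩ X)
    U∩X-ind = let e , e∈X , e∉U = p⊈q⇒∃x∈p∖q X⊈U in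
      X-minimal (U ∩ X) (p∩q⊆q U X , e , e∈X , λ e∈U∩X → e∉U (p∩q⊆p U X e∈U∩X))
    swap : ∀ a b c → a ℕ.+ b ℕ.+ c ≡ a ℕ.+ c ℕ.+ b
    swap = ℕ-Solver.solve-∀
    regroup : ∀ a b m → a ℕ.+ b ℕ.+ suc m ≡ (a ℕ.+ m) ℕ.+ suc b
    regroup = ℕ-Solver.solve-∀

RankBounded : ∀ {d} → Matroid d → (Subset d → ℤ) → Set
RankBounded N h = ∀ A → ℤ.+ MatroidRank.rank N A ℤ.≤ h A

UpdateAt-preserves : ∀ {d} {h g : Subset d → ℤ} {C z} (P : Subset d → ℤ → Set) →
                     UpdateAt h C z g → P C z → (∀ D → P D (h D)) → ∀ D → P D (g D)
UpdateAt-preserves {C = C} P g≡h[C≔z] P-z P-h D with ≡-dec Bool._≟_ D C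
... | yes refl = subst (P D) (sym (proj₁ (g≡h[C≔z] D) refl)) P-z
... | no D≢C   = subst (P D) (sym (proj₂ (g≡h[C≔z] D) D≢C)) (P-h D)

step-decreasing : ∀ {d} {𝒳 : Family d} {h g} → Step 𝒳 h g → ∀ D → g D ℤ.≤ h D
step-decreasing {h = h} (step-i _ _ _ (_ , _ , rhs<h) upd) =
  UpdateAt-preserves (λ D y → y ℤ.≤ h D) upd (ℤ.<⇒≤ rhs<h) (λ _ → ℤ.≤-refl)
step-decreasing {h = h} (step-ii _ _ _ (_ , h-B<h-A) upd) =
  UpdateAt-preserves (λ D y → y ℤ.≤ h D) upd (ℤ.<⇒≤ h-B<h-A) (λ _ → ℤ.≤-refl)
step-decreasing {h = h} (step-iii _ _ _ _ (_ , rhs<h) upd) =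
  UpdateAt-preserves (λ D y → y ℤ.≤ h D) upd (ℤ.<⇒≤ rhs<h) (λ _ → ℤ.≤-refl)

run-decreasing : ∀ {d} {𝒳 : Family d} {h g} → Star (Step 𝒳) h g → ∀ D → g D ℤ.≤ h D
run-decreasing = Star.fold (λ h g → ∀ D → g D ℤ.≤ h D)
  (λ step g≤h D → ℤ.≤-trans (g≤h D) (step-decreasing step D)) (λ _ → ℤ.≤-refl)

module _ {d} {𝒳 : Family d} {N : Matroid d} (N-X : IsXMatroid 𝒳 N) where
  open MatroidRank N

  deficit-properFrom : ∀ {U m} S → ProperFrom 𝒳 U S → RankDeficit U m →
                       RankDeficit (U ∪ ⋃ S) (m ℕ.+ length S)
  deficit-properFrom {U} {m} [] _ U-deficit =
    subst₂ RankDeficit (sym (∪-identityʳ U)) (sym (ℕ.+-identityʳ m)) U-deficit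
  deficit-properFrom {U} {m} (X ∷ S) (X∈𝒳 , X⊈U , S-proper) U-deficit =
    subst₂ RankDeficit (∪-assoc U X (⋃ S)) (sym (ℕ.+-suc m (length S)))
      (deficit-properFrom S S-proper (rank-∪-circuit (N-X X X∈𝒳) X⊈U U-deficit))

  deficit-proper : ∀ S → Proper 𝒳 S → RankDeficit (⋃ S) (length S)
  deficit-proper []      _                  = ℕ.≤-trans (ℕ.≤-reflexive (ℕ.+-identityʳ _)) (rank≤∣∣ ⊥)
  deficit-proper (X ∷ S) (X∈𝒳 , S-proper) = deficit-properFrom S S-proper X-deficit
    where
    X-deficit : RankDeficit X 1
    X-deficit = subst (ℕ._≤ ∣ X ∣) (ℕ.+-comm 1 (rank X)) (dependent⇒rank<∣∣ (proj₁ (N-X X X∈𝒳)))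

  rank≤val : ∀ {S} → Proper 𝒳 S → ∀ F → ℤ.+ rank F ℤ.≤ val F S
  rank≤val {S} S-proper F = m+k≤n⇒+m≤+n-+k (begin
    rank F ℕ.+ k                                   ≤⟨ ℕ.+-monoˡ-≤ k (rank-mono (p⊆p∪q W)) ⟩
    rank (F ∪ W) ℕ.+ k                             ≤⟨ ℕ.+-monoˡ-≤ k (rank-unit-increase (F ∪ W) W) ⟩
    rank W ℕ.+ ∣ (F ∪ W) ─ W ∣ ℕ.+ k             ≡⟨ swap (rank W) ∣ (F ∪ W) ─ W ∣ k ⟩
    rank W ℕ.+ k ℕ.+ ∣ (F ∪ W) ─ W ∣             ≤⟨ ℕ.+-monoˡ-≤ _ (deficit-proper S S-proper) ⟩
    ∣ W ∣ ℕ.+ ∣ (F ∪ W) ─ W ∣                     ≤⟨ ℕ.+-monoˡ-≤ _ (p⊆q⇒∣p∣≤∣q∣ W⊆[F∪W]∩W) ⟩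
    ∣ (F ∪ W) ∩ W ∣ ℕ.+ ∣ (F ∪ W) ─ W ∣         ≡⟨ ∣p∩q∣+∣p─q∣≡∣p∣ (F ∪ W) W ⟩
    ∣ F ∪ W ∣                                      ∎)
    where
    open ℕ.≤-Reasoning
    W : Subset d
    W = ⋃ S
    k : ℕ
    k = length S
    W⊆[F∪W]∩W : W ⊆ (F ∪ W) ∩ W
    W⊆[F∪W]∩W = ∩-greatest (q⊆p∪q F W) ⊆-refl
    swap : ∀ a b c → a ℕ.+ b ℕ.+ c ≡ a ℕ.+ c ℕ.+ b
    swap = ℕ-Solver.solve-∀

  rank≤rhs-i : ∀ {h} → RankBounded N h → ∀ {A B x} → x ∈𝒳 𝒳 → A ∩ B ⊆ x →
               ℤ.+ rank (A ∪ B) ℤ.≤ rhs-i h A B x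
  rank≤rhs-i {h} h-bound {A} {B} {x} x∈𝒳 A∩B⊆x = begin
    ℤ.+ rank (A ∪ B)                        ≤⟨ i+j≤k⇒i≤k-j {j = ℤ.+ rank (A ∩ B)} submodular-h ⟩
    h A ℤ.+ h B ℤ.- ℤ.+ rank (A ∩ B)      ≤⟨ ℤ.+-monoʳ-≤ (h A ℤ.+ h B) (ℤ.neg-mono-≤ overlap≤rank) ⟩
    rhs-i h A B x                            ∎
    where
    open ℤ.≤-Reasoning
    submodular-h : ℤ.+ rank (A ∪ B) ℤ.+ ℤ.+ rank (A ∩ B) ℤ.≤ h A ℤ.+ h B
    submodular-h = begin
      ℤ.+ rank (A ∪ B) ℤ.+ ℤ.+ rank (A ∩ B) ≡⟨ ℤ.pos-+ (rank (A ∪ B)) (rank (A ∩ B)) ⟨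
      ℤ.+ (rank (A ∪ B) ℕ.+ rank (A ∩ B))    ≤⟨ ℤ.+≤+ (rank-submodular A B) ⟩
      ℤ.+ (rank A ℕ.+ rank B)                 ≡⟨ ℤ.pos-+ (rank A) (rank B) ⟩
      ℤ.+ rank A ℤ.+ ℤ.+ rank B              ≤⟨ ℤ.+-mono-≤ (h-bound A) (h-bound B) ⟩
      h A ℤ.+ h B                              ∎
    overlap≤rank : ℤ.+ ∣ A ∩ B ∣ ℤ.⊓ (ℤ.+ ∣ x ∣ ℤ.- ℤ.+ 1) ℤ.≤ ℤ.+ rank (A ∩ B)
    overlap≤rank with x ⊆? A ∩ B
    ... | yes x⊆A∩B = ℤ.≤-trans (ℤ.i⊓j≤j _ _)
      (ℤ.+-monoˡ-≤ (ℤ.- ℤ.+ 1) (ℤ.+≤+ (ℕ.≤-trans (circuit-rank (N-X x x∈𝒳)) (s≤s (rank-mono x⊆A∩B)))))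
    ... | no x⊈A∩B = ℤ.≤-trans (ℤ.i⊓j≤i _ _)
      (ℤ.+≤+ (independent⇒∣∣≤rank ⊆-refl (proj₂ (N-X x x∈𝒳) (A ∩ B) (A∩B⊆x , p⊈q⇒∃x∈p∖q x⊈A∩B))))

  valX-RankBounded : ∀ {h} → IsValX 𝒳 h → RankBounded N h
  valX-RankBounded h-isVal A =
    let S , S-proper , val≡h = proj₁ (h-isVal A) in subst (_ ℤ.≤_) val≡h (rank≤val S-proper A)

  step-preserves-RankBounded : ∀ {h g} → Step 𝒳 h g → RankBounded N h → RankBounded N g
  step-preserves-RankBounded (step-i A B x (x∈𝒳 , A∩B⊆x , _) upd) h-bound =
    UpdateAt-preserves (λ D y → ℤ.+ rank D ℤ.≤ y) upd (rank≤rhs-i h-bound x∈𝒳 A∩B⊆x) h-bound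
  step-preserves-RankBounded (step-ii A B _ (A⊂B , _) upd) h-bound =
    UpdateAt-preserves (λ D y → ℤ.+ rank D ℤ.≤ y) upd
      (ℤ.≤-trans (ℤ.+≤+ (rank-mono (p⊂q⇒p⊆q A⊂B))) (h-bound B)) h-bound
  step-preserves-RankBounded {h} (step-iii A B _ _ _ upd) h-bound =
    UpdateAt-preserves (λ D y → ℤ.+ rank D ℤ.≤ y) upd A-bound h-bound
    where
    A-bound : ℤ.+ rank A ℤ.≤ h B ℤ.+ ℤ.+ ∣ A ─ B ∣
    A-bound = begin
      ℤ.+ rank A                         ≤⟨ ℤ.+≤+ (rank-unit-increase A B) ⟩
      ℤ.+ (rank B ℕ.+ ∣ A ─ B ∣)        ≡⟨ ℤ.pos-+ (rank B) ∣ A ─ B ∣ ⟩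
      ℤ.+ rank B ℤ.+ ℤ.+ ∣ A ─ B ∣     ≤⟨ ℤ.+-monoˡ-≤ (ℤ.+ ∣ A ─ B ∣) (h-bound B) ⟩
      h B ℤ.+ ℤ.+ ∣ A ─ B ∣             ∎
      where open ℤ.≤-Reasoning

  run-preserves-RankBounded : ∀ {h g} → Star (Step 𝒳) h g → RankBounded N h → RankBounded N g
  run-preserves-RankBounded = Star.fold (λ h g → RankBounded N h → RankBounded N g)
    (λ step preserve → preserve ∘ step-preserves-RankBounded step) id

NoRule-ii⇒monotone : ∀ {d} {h : Subset d → ℤ} → NoRule-ii h → ∀ {A B} → A ⊆ B → h A ℤ.≤ h B
NoRule-ii⇒monotone no-ii A⊆B with p⊆q⇒p≡q⊎p⊂q A⊆B
... | inj₁ refl = ℤ.≤-refl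
... | inj₂ A⊂B = ℤ.≮⇒≥ (λ hB<hA → no-ii _ _ (A⊂B , hB<hA))

NoRule-iii⇒unit-increase : ∀ {d} {h : Subset d → ℤ} → NoRule-iii h →
                           ∀ {A B} → B ⊆ A → h A ℤ.≤ h B ℤ.+ ℤ.+ ∣ A ─ B ∣
NoRule-iii⇒unit-increase no-iii B⊆A with p⊆q⇒p≡q⊎p⊂q B⊆A
... | inj₁ refl = ℤ.i≤i+j _ _
... | inj₂ B⊂A = ℤ.≮⇒≥ (λ rhs<hA → no-iii _ _ (B⊂A , rhs<hA))

module RankMatroid {d} (r : Subset d → ℤ) (r-⊥ : r ⊥ ≡ ℤ.0ℤ)
  (r-mono : ∀ {A B} → A ⊆ B → r A ℤ.≤ r B)
  (r-unit-increase : ∀ {A B} → B ⊆ A → r A ℤ.≤ r B ℤ.+ ℤ.+ ∣ A ─ B ∣)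
  (r-submodular : Submodular r) where

  r≤∣∣ : ∀ A → r A ℤ.≤ ℤ.+ ∣ A ∣
  r≤∣∣ A = begin
    r A                         ≤⟨ r-unit-increase (⊆-min A) ⟩
    r ⊥ ℤ.+ ℤ.+ ∣ A ─ ⊥ ∣    ≡⟨ cong₂ (λ z B → z ℤ.+ ℤ.+ ∣ B ∣) r-⊥ (p─⊥≡p A) ⟩
    ℤ.0ℤ ℤ.+ ℤ.+ ∣ A ∣       ≡⟨ ℤ.+-identityˡ _ ⟩
    ℤ.+ ∣ A ∣                 ∎
    where open ℤ.≤-Reasoning

  r-∪-≤ : ∀ {I A B} → I ⊆ A ∩ B → r A ℤ.≤ r I → r B ℤ.≤ r I → r (A ∪ B) ℤ.≤ r I
  r-∪-≤ {I} {A} {B} I⊆A∩B rA≤rI rB≤rI = i+k≤j+k⇒i≤j (r I) (begin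
    r (A ∪ B) ℤ.+ r I           ≤⟨ ℤ.+-monoʳ-≤ (r (A ∪ B)) (r-mono I⊆A∩B) ⟩
    r (A ∪ B) ℤ.+ r (A ∩ B)     ≤⟨ r-submodular A B ⟩
    r A ℤ.+ r B                  ≤⟨ ℤ.+-mono-≤ rA≤rI rB≤rI ⟩
    r I ℤ.+ r I                  ∎)
    where open ℤ.≤-Reasoning

  r-span : ∀ I E → (∀ e → e ∈ E → e ∉ I → r (⁅ e ⁆ ∪ I) ℤ.≤ r I) → r (I ∪ E) ℤ.≤ r I
  r-span I E = go (⊂-wellFounded E)
    where
    go : ∀ {E} → Acc _⊂_ E → (∀ e → e ∈ E → e ∉ I → r (⁅ e ⁆ ∪ I) ℤ.≤ r I) → r (I ∪ E) ℤ.≤ r I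
    go {E} (acc smaller) no-gain with nonempty? E
    ... | no E-empty = r-mono (∪-least ⊆-refl (λ x∈E → ⊥-elim (E-empty (_ , x∈E))))
    ... | yes (e , e∈E) = ℤ.≤-trans (r-mono I∪E⊆A∪B)
          (r-∪-≤ (∩-greatest (p⊆p∪q (E - e)) (q⊆p∪q ⁅ e ⁆ I)) rA≤rI rB≤rI)
      where
      A B : Subset d
      A = I ∪ (E - e)
      B = ⁅ e ⁆ ∪ I
      rA≤rI : r A ℤ.≤ r I
      rA≤rI = go (smaller (x∈p⇒p-x⊂p e∈E)) (λ f f∈E-e → no-gain f (p─q⊆p E ⁅ e ⁆ f∈E-e))
      rB≤rI : r B ℤ.≤ r I
      rB≤rI with e ∈? I
      ... | yes e∈I = r-mono (∪-least (x∈p⇒⁅x⁆⊆p e∈I) ⊆-refl)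
      ... | no e∉I  = no-gain e e∈E e∉I
      I∪E⊆A∪B : I ∪ E ⊆ A ∪ B
      I∪E⊆A∪B = ∪-least (⊆-trans (p⊆p∪q (E - e)) (p⊆p∪q B))
        (⊆-trans (p⊆⁅x⁆∪p-x E e)
          (∪-least (⊆-trans (p⊆p∪q I) (q⊆p∪q A B)) (⊆-trans (q⊆p∪q I (E - e)) (p⊆p∪q B))))

  indepʳ : Subset d → Bool
  indepʳ I = does (ℤ.+ ∣ I ∣ ℤ.≤? r I)

  indepʳ⁺ : ∀ {I} → ℤ.+ ∣ I ∣ ℤ.≤ r I → indepʳ I ≡ true
  indepʳ⁺ {I} = dec-true (ℤ.+ ∣ I ∣ ℤ.≤? r I)

  indepʳ⁻ : ∀ {I} → indepʳ I ≡ true → ℤ.+ ∣ I ∣ ℤ.≤ r I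
  indepʳ⁻ {I} = does≡true⇒ (ℤ.+ ∣ I ∣ ℤ.≤? r I)

  depʳ⁺ : ∀ {I} → ¬ ℤ.+ ∣ I ∣ ℤ.≤ r I → indepʳ I ≡ false
  depʳ⁺ {I} = dec-false (ℤ.+ ∣ I ∣ ℤ.≤? r I)

  depʳ⁻ : ∀ {I} → indepʳ I ≡ false → ¬ ℤ.+ ∣ I ∣ ℤ.≤ r I
  depʳ⁻ {I} = does≡false⇒ (ℤ.+ ∣ I ∣ ℤ.≤? r I)

  indepʳ-hereditary : ∀ {I J} → J ⊆ I → indepʳ I ≡ true → indepʳ J ≡ true
  indepʳ-hereditary {I} {J} J⊆I I-ind = indepʳ⁺ (i+k≤j+k⇒i≤j (ℤ.+ ∣ I ─ J ∣) (begin
    ℤ.+ ∣ J ∣ ℤ.+ ℤ.+ ∣ I ─ J ∣    ≡⟨ ℤ.pos-+ ∣ J ∣ ∣ I ─ J ∣ ⟨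
    ℤ.+ (∣ J ∣ ℕ.+ ∣ I ─ J ∣)       ≤⟨ ℤ.+≤+ ∣J∣+∣I─J∣≤∣I∣ ⟩
    ℤ.+ ∣ I ∣                        ≤⟨ indepʳ⁻ I-ind ⟩
    r I                              ≤⟨ r-unit-increase J⊆I ⟩
    r J ℤ.+ ℤ.+ ∣ I ─ J ∣           ∎))
    where
    open ℤ.≤-Reasoning
    ∣J∣+∣I─J∣≤∣I∣ : ∣ J ∣ ℕ.+ ∣ I ─ J ∣ ℕ.≤ ∣ I ∣
    ∣J∣+∣I─J∣≤∣I∣ = ℕ.≤-trans (ℕ.+-monoˡ-≤ _ (p⊆q⇒∣p∣≤∣q∣ (∩-greatest J⊆I ⊆-refl)))
                               (ℕ.≤-reflexive (∣p∩q∣+∣p─q∣≡∣p∣ I J))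

  dependent-extension : ∀ {I e} → indepʳ I ≡ true → indepʳ (⁅ e ⁆ ∪ I) ≡ false →
                        r (⁅ e ⁆ ∪ I) ℤ.≤ r I
  dependent-extension {I} {e} I-ind I+e-dep = begin
    r (⁅ e ⁆ ∪ I)               ≤⟨ ℤ.i<j⇒i≤pred[j] (ℤ.≰⇒> (depʳ⁻ I+e-dep)) ⟩
    ℤ.pred (ℤ.+ ∣ ⁅ e ⁆ ∪ I ∣) ≤⟨ ℤ.pred-mono (ℤ.+≤+ (∣⁅x⁆∪p∣≤1+∣p∣ e I)) ⟩
    ℤ.+ ∣ I ∣                   ≤⟨ indepʳ⁻ I-ind ⟩
    r I                         ∎
    where open ℤ.≤-Reasoning

  r-span-independent : ∀ {I E} → indepʳ I ≡ true →
                       (∀ e → e ∈ E → e ∉ I → indepʳ (⁅ e ⁆ ∪ I) ≡ false) → r E ℤ.≤ ℤ.+ ∣ I ∣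
  r-span-independent {I} {E} I-ind maximal = begin
    r E       ≤⟨ r-mono (q⊆p∪q I E) ⟩
    r (I ∪ E) ≤⟨ r-span I E (λ e e∈E e∉I → dependent-extension I-ind (maximal e e∈E e∉I)) ⟩
    r I       ≤⟨ r≤∣∣ I ⟩
    ℤ.+ ∣ I ∣ ∎
    where open ℤ.≤-Reasoning

  indepʳ-augment : ∀ {I J} → indepʳ I ≡ true → indepʳ J ≡ true → ∣ I ∣ ℕ.< ∣ J ∣ →
                   ∃[ e ] (e ∈ J × e ∉ I × indepʳ (⁅ e ⁆ ∪ I) ≡ true)
  indepʳ-augment {I} {J} I-ind J-ind ∣I∣<∣J∣
    with Fin.any? (λ e → e ∈? J ×-dec ¬? (e ∈? I) ×-dec (indepʳ (⁅ e ⁆ ∪ I) Bool.≟ true))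
  ... | yes e-augments = e-augments
  ... | no ∄e = contradiction ∣I∣<∣J∣ (ℕ.≤⇒≯ (ℤ.drop‿+≤+ (ℤ.≤-trans (indepʳ⁻ J-ind)
      (r-span-independent I-ind λ e e∈J e∉I → Bool.¬-not (λ I+e-ind → ∄e (e , e∈J , e∉I , I+e-ind))))))

  M : Matroid d
  M = record
    { indep   = indepʳ
    ; indep-⊥ = indepʳ⁺ (subst₂ ℤ._≤_ (cong ℤ.+_ (sym (∣⊥∣≡0 d))) (sym r-⊥) ℤ.≤-refl)
    ; indep-⊆ = indepʳ-hereditary
    ; augment = indepʳ-augment
    }

  r-isRankFunction : IsRankFunction M r
  r-isRankFunction A =
    (J , ⊆E , independent , ℤ.≤-antisym (ℤ.≤-trans (indepʳ⁻ independent) (r-mono ⊆E))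
                                        (r-span-independent independent maximal)) ,
    λ I I⊆A I-ind → ℤ.≤-trans (indepʳ⁻ I-ind) (r-mono I⊆A)
    where
    open MatroidRank M using (basisOf; basisOf-isBasis; module IsBasis)
    J : Subset d
    J = basisOf A
    open IsBasis (basisOf-isBasis A)

  M-least : ∀ N → RankBounded N r → M ≼ N
  M-least N r-bound A A-dep = Bool.¬-not λ A-ind →
    depʳ⁻ A-dep (ℤ.≤-trans (ℤ.+≤+ (MatroidRank.independent⇒∣∣≤rank N ⊆-refl A-ind)) (r-bound A))

  M-isXMatroid : ∀ 𝒳 {N} → IsXMatroid 𝒳 N → RankBounded N r → (∀ X → X ∈𝒳 𝒳 → r X ℤ.< ℤ.+ ∣ X ∣) →
                 IsXMatroid 𝒳 M
  M-isXMatroid 𝒳 {N} N-X r-bound r<∣∣ X X∈𝒳 =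
    depʳ⁺ (ℤ.<⇒≱ (r<∣∣ X X∈𝒳)) ,
    λ D D⊂X → indepʳ⁺ (ℤ.≤-trans
      (ℤ.+≤+ (MatroidRank.independent⇒∣∣≤rank N ⊆-refl (proj₂ (N-X X X∈𝒳) D D⊂X))) (r-bound D))

val-[] : ∀ {d} (F : Subset d) → val F [] ≡ ℤ.+ ∣ F ∣
val-[] F rewrite ∪-identityʳ F = ℤ.+-identityʳ _

val-[X] : ∀ {d} (X : Subset d) → val X (X ∷ []) ≡ ℤ.+ ∣ X ∣ ℤ.- ℤ.+ 1
val-[X] X rewrite ∪-identityʳ X | ∪-idem X = refl

lemma6p10 : (d : ℕ) (𝒳 : Family d) →
    (∀ X → X ∈𝒳 𝒳 → Nonempty X) →
    (v : Subset d → ℤ) → IsVX 𝒳 v →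
    Submodular v →
    (∃[ N ] IsXMatroid 𝒳 N) →
    ∃[ M ] (IsXMatroid 𝒳 M × IsRankFunction M v ×
      -- M is minimal among 𝒳-matroids in the dependency order
      (∀ N → IsXMatroid 𝒳 N → N ≼ M → M ≼ N) ×
      -- and it is the unique minimal one
      (∀ N → IsXMatroid 𝒳 N →
        (∀ N′ → IsXMatroid 𝒳 N′ → N′ ≼ N → N ≼ N′) →
        N ≼ M × M ≼ N))
lemma6p10 d 𝒳 _ v (h₁ , h₁-isVal , run , _ , no-ii , no-iii) v-submodular (N₀ , N₀-X) =
  M , M-X , r-isRankFunction , (λ N N-X _ → M≼ N N-X) ,
  (λ N N-X N-minimal → N-minimal M M-X (M≼ N N-X) , M≼ N N-X)
  where
  v-bound : ∀ N → IsXMatroid 𝒳 N → RankBounded N v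
  v-bound N N-X = run-preserves-RankBounded N-X run (valX-RankBounded N-X h₁-isVal)
  v≤val : ∀ F S → Proper 𝒳 S → v F ℤ.≤ val F S
  v≤val F S S-proper = ℤ.≤-trans (run-decreasing run F) (proj₂ (h₁-isVal F) S S-proper)
  v-⊥ : v ⊥ ≡ ℤ.0ℤ
  v-⊥ = ℤ.≤-antisym
    (subst (v ⊥ ℤ.≤_) (trans (val-[] (⊥ {d})) (cong ℤ.+_ (∣⊥∣≡0 d))) (v≤val ⊥ [] tt))
    (ℤ.≤-trans (ℤ.+≤+ z≤n) (v-bound N₀ N₀-X ⊥))
  v<∣∣ : ∀ X → X ∈𝒳 𝒳 → v X ℤ.< ℤ.+ ∣ X ∣
  v<∣∣ X X∈𝒳 = ℤ.≤-<-trans (subst (v X ℤ.≤_) (val-[X] X) (v≤val X (X ∷ []) (X∈𝒳 , tt)))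
                           (ℤ.m⊖1+n<m ∣ X ∣ 1)
  open RankMatroid v v-⊥ (NoRule-ii⇒monotone no-ii) (NoRule-iii⇒unit-increase no-iii) v-submodular
  M-X : IsXMatroid 𝒳 M
  M-X = M-isXMatroid 𝒳 N₀-X (v-bound N₀ N₀-X) v<∣∣
  M≼ : ∀ N → IsXMatroid 𝒳 N → M ≼ N
  M≼ N N-X = M-least N (v-bound N N-X)
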